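{- Let $t$ be a positive integer and let $M$ be a matroid with the $(t,2t)$-property. Then $M$ has no restriction isomorphic to the uniform matroid $U_{t,3t}$.
   Context: A matroid $M$ has the $(t,\ell)$-property if every $t$-element subset of $E(M)$ is contained in both an $\ell$-element circuit and an $\ell$-element cocircuit of $M$. -}

module Defs where

open import Data.Nat using (ℕ; _<_; _≤_; _*_)
open import Data.Fin using (Fin)
open import Data.Fin.Subset using (Subset; ⊥; ⁅_⁆; _∈_; _∉_; _⊆_; _⊂_; ∁; _∪_; ∣_∣)
open import Data.Product using (Σ; ∃; _×_)
open import Relation.Nullary using (¬_)
open import Relation.Binary.PropositionalEquality using (_≡_)
open import Function.Bundles using (_⇔_)

record Matroid (n : ℕ) : Set₁ where
  field
    Indep : Subset n → Set
    indep-∅ : Indep ⊥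
    indep-⊆ : ∀ {X Y} → Y ⊆ X → Indep X → Indep Y
    indep-aug : ∀ {X Y} → Indep X → Indep Y → ∣ X ∣ < ∣ Y ∣ →
                ∃ λ e → e ∈ Y × e ∉ X × Indep (X ∪ ⁅ e ⁆)

module _ {n : ℕ} (M : Matroid n) where
  open Matroid M

  IsCircuit : Subset n → Set
  IsCircuit C = ¬ Indep C × (∀ Y → Y ⊂ C → Indep Y)

  IsBasis : Subset n → Set
  IsBasis B = Indep B × (∀ X → Indep X → B ⊆ X → X ≡ B)

  -- independent in the dual matroid M*: complement contains a basis of M
  CoIndep : Subset n → Set
  CoIndep I = ∃ λ B → IsBasis B × B ⊆ ∁ I

  IsCocircuit : Subset n → Set
  IsCocircuit C = ¬ CoIndep C × (∀ Y → Y ⊂ C → CoIndep Y)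

  HasProperty : ℕ → ℕ → Set
  HasProperty t ℓ = ∀ T → ∣ T ∣ ≡ t →
      (∃ λ C → IsCircuit C × T ⊆ C × ∣ C ∣ ≡ ℓ)
    × (∃ λ D → IsCocircuit D × T ⊆ D × ∣ D ∣ ≡ ℓ)

  -- M has a restriction M|X isomorphic to U_{r,m}: |X| = m and the independent
  -- sets of M|X (subsets of X independent in M) are exactly those of size ≤ r.
  HasUniformRestriction : ℕ → ℕ → Set
  HasUniformRestriction r m = ∃ λ X → ∣ X ∣ ≡ m × (∀ Y → Y ⊆ X → (Indep Y ⇔ ∣ Y ∣ ≤ r))

module Submission where

-- Let X be a 3t-element set with M|X ≅ U_{t,3t}.  Pick a
-- t-subset T of X, a 2t-element cocircuit D ⊇ T and an element e ∈ T.
-- Since |X ─ D| ≥ 3t - 2t = t, there is a t-subset Y of X avoiding D.  In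
-- U_{t,3t} the set Y is independent while Y ∪ {e} (of size t + 1) is not.
-- This contradicts the fact that the complement of a cocircuit is closed
-- (a hyperplane): an independent set avoiding D never spans an element of D.
-- Only the cocircuit half of the (t, 2t)-property is needed.

open import Defs
open import Data.Nat using (ℕ; _≤_; _*_)
open import Relation.Nullary using (¬_)

open import Data.Nat using (zero; suc; _+_; _∸_; _<_; z≤n; s≤s)
open import Data.Nat.Properties
  using (≤-pred; +-suc; ≤-trans; ≤-reflexive; <-irrefl; +-cancelˡ-≤; m+[n∸m]≡n;
         +-monoʳ-≤; ≮⇒≥; n≮n; +-identityʳ; *-distribʳ-+; m≤n*m; n≤1+n; module ≤-Reasoning)
open import Data.Fin using () renaming (zero to fz; suc to fs)
open import Data.Fin.Subset
  using (Subset; _∈_; _∉_; _⊆_; ∁; _∪_; _─_; _-_; ⁅_⁆; ∣_∣; inside; outside)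
  renaming (⊥ to ∅)
open import Data.Fin.Subset.Properties
  using (out⊆; in⊆in; ⊥⊆; ∣⊥∣≡0; drop-∷-⊆; p⊆q⇒∣p∣≤∣q∣; ∪-identityʳ; x∈p⇒p-x⊂p;
         _∈?_; x∈p∪q⁻; x∈⁅x⁆; x∈⁅y⁆⇒x≡y; p⊆p∪q; q⊆p∪q; x∈∁p⇒x∉p;
         x∉p⇒x∈∁p; x∈p∧x≢y⇒x∈p-y; x∉⁅y⁆⇒x≢y; p─q⊆p; p─⊥≡p)
open import Data.Vec using ([]; _∷_; here; there)
open import Data.Product using (∃; _×_; _,_; proj₁; proj₂)
open import Data.Sum using (inj₁; inj₂)
open import Data.Empty using (⊥-elim)
open import Relation.Nullary using (Dec; yes; no)
open import Relation.Binary.PropositionalEquality using (_≡_; _≢_; refl; sym; trans; cong; subst)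
open import Function.Bundles using (Equivalence)

∣p∪⁅x⁆∣≡1+∣p∣ : ∀ {n} (p : Subset n) x → x ∉ p → ∣ p ∪ ⁅ x ⁆ ∣ ≡ suc ∣ p ∣
∣p∪⁅x⁆∣≡1+∣p∣ (inside ∷ p)  fz     x∉p = ⊥-elim (x∉p here)
∣p∪⁅x⁆∣≡1+∣p∣ (outside ∷ p) fz     x∉p = cong (λ q → suc ∣ q ∣) (∪-identityʳ p)
∣p∪⁅x⁆∣≡1+∣p∣ (inside ∷ p)  (fs x) x∉p = cong suc (∣p∪⁅x⁆∣≡1+∣p∣ p x (λ x∈p → x∉p (there x∈p)))
∣p∪⁅x⁆∣≡1+∣p∣ (outside ∷ p) (fs x) x∉p = ∣p∪⁅x⁆∣≡1+∣p∣ p x (λ x∈p → x∉p (there x∈p))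

1+∣p-x∣≡∣p∣ : ∀ {n} (p : Subset n) x → x ∈ p → suc ∣ p - x ∣ ≡ ∣ p ∣
1+∣p-x∣≡∣p∣ (inside ∷ p)  fz     here        = cong (λ q → suc ∣ q ∣) (p─⊥≡p p)
1+∣p-x∣≡∣p∣ (inside ∷ p)  (fs x) (there x∈p) = cong suc (1+∣p-x∣≡∣p∣ p x x∈p)
1+∣p-x∣≡∣p∣ (outside ∷ p) (fs x) (there x∈p) = 1+∣p-x∣≡∣p∣ p x x∈p

x∈p─q⁻ : ∀ {n} (p q : Subset n) x → x ∈ p ─ q → x ∈ p × x ∉ q
x∈p─q⁻ (inside ∷ p)  (outside ∷ q) fz     here        = here , λ ()
x∈p─q⁻ (outside ∷ p) (inside ∷ q)  fz     ()
x∈p─q⁻ (outside ∷ p) (outside ∷ q) fz     ()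
x∈p─q⁻ (_ ∷ p)       (_ ∷ q)       (fs x) (there x∈p─q) with x∈p─q⁻ p q x x∈p─q
... | x∈p , x∉q = there x∈p , λ { (there x∈q) → x∉q x∈q }

subset-of-size : ∀ {n} k (p : Subset n) → k ≤ ∣ p ∣ → ∃ λ q → q ⊆ p × ∣ q ∣ ≡ k
subset-of-size zero    []            _ = [] , (λ ()) , refl
subset-of-size {suc n} zero (inside ∷ p) _ = ∅ , ⊥⊆ , ∣⊥∣≡0 (suc n)
subset-of-size (suc k) (inside ∷ p)  k≤∣p∣ with subset-of-size k p (≤-pred k≤∣p∣)
... | q , q⊆p , ∣q∣≡k = inside ∷ q , in⊆in q⊆p , cong suc ∣q∣≡k
subset-of-size k       (outside ∷ p) k≤∣p∣ with subset-of-size k p k≤∣p∣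
... | q , q⊆p , ∣q∣≡k = outside ∷ q , out⊆ q⊆p , ∣q∣≡k

member-of-nonempty : ∀ {n} (p : Subset n) → 1 ≤ ∣ p ∣ → ∃ λ x → x ∈ p
member-of-nonempty (inside ∷ p)  _ = fz , here
member-of-nonempty (outside ∷ p) 1≤∣p∣ with member-of-nonempty p 1≤∣p∣
... | x , x∈p = fs x , there x∈p

∣p∣≤∣q∣+∣p─q∣ : ∀ {n} (p q : Subset n) → ∣ p ∣ ≤ ∣ q ∣ + ∣ p ─ q ∣
∣p∣≤∣q∣+∣p─q∣ []           []           = z≤n
∣p∣≤∣q∣+∣p─q∣ (inside ∷ p)  (inside ∷ q)  = s≤s (∣p∣≤∣q∣+∣p─q∣ p q)
∣p∣≤∣q∣+∣p─q∣ (inside ∷ p)  (outside ∷ q) =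
  subst (suc ∣ p ∣ ≤_) (sym (+-suc ∣ q ∣ _)) (s≤s (∣p∣≤∣q∣+∣p─q∣ p q))
∣p∣≤∣q∣+∣p─q∣ (outside ∷ p) (inside ∷ q)  = ≤-trans (∣p∣≤∣q∣+∣p─q∣ p q) (n≤1+n _)
∣p∣≤∣q∣+∣p─q∣ (outside ∷ p) (outside ∷ q) = ∣p∣≤∣q∣+∣p─q∣ p q

⊆-∣∣≤⇒≡ : ∀ {n} (p q : Subset n) → p ⊆ q → ∣ q ∣ ≤ ∣ p ∣ → q ≡ p
⊆-∣∣≤⇒≡ []           []           _   _ = refl
⊆-∣∣≤⇒≡ (inside ∷ p)  (inside ∷ q)  p⊆q ∣q∣≤∣p∣ =
  cong (inside ∷_) (⊆-∣∣≤⇒≡ p q (drop-∷-⊆ p⊆q) (≤-pred ∣q∣≤∣p∣))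
⊆-∣∣≤⇒≡ (inside ∷ p)  (outside ∷ q) p⊆q _ with p⊆q here
... | ()
⊆-∣∣≤⇒≡ (outside ∷ p) (outside ∷ q) p⊆q ∣q∣≤∣p∣ =
  cong (outside ∷_) (⊆-∣∣≤⇒≡ p q (drop-∷-⊆ p⊆q) ∣q∣≤∣p∣)
⊆-∣∣≤⇒≡ (outside ∷ p) (inside ∷ q)  p⊆q ∣q∣≤∣p∣ =
  ⊥-elim (<-irrefl refl (≤-trans ∣q∣≤∣p∣ (p⊆q⇒∣p∣≤∣q∣ (drop-∷-⊆ p⊆q))))

∪⁅⁆-⊆ : ∀ {n} {p r : Subset n} {x} → p ⊆ r → x ∈ r → p ∪ ⁅ x ⁆ ⊆ r
∪⁅⁆-⊆ {p = p} {x = x} p⊆r x∈r y∈p∪x with x∈p∪q⁻ p ⁅ x ⁆ y∈p∪x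
... | inj₁ y∈p = p⊆r y∈p
... | inj₂ y∈x = subst (_∈ _) (sym (x∈⁅y⁆⇒x≡y x y∈x)) x∈r

3t-2t≥t : ∀ {n} t (p q : Subset n) → ∣ p ∣ ≡ 3 * t → ∣ q ∣ ≡ 2 * t → t ≤ ∣ p ─ q ∣
3t-2t≥t t p q ∣p∣≡3t ∣q∣≡2t = +-cancelˡ-≤ (2 * t) t ∣ p ─ q ∣ (begin
  2 * t + t          ≡⟨ 3t≡2t+t ⟨
  3 * t              ≡⟨ ∣p∣≡3t ⟨
  ∣ p ∣              ≤⟨ ∣p∣≤∣q∣+∣p─q∣ p q ⟩
  ∣ q ∣ + ∣ p ─ q ∣  ≡⟨ cong (_+ ∣ p ─ q ∣) ∣q∣≡2t ⟩
  2 * t + ∣ p ─ q ∣  ∎)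
  where
  open ≤-Reasoning
  3t≡2t+t : 3 * t ≡ 2 * t + t
  3t≡2t+t = trans (*-distribʳ-+ t 2 1) (cong (2 * t +_) (+-identityʳ t))

module MatroidFacts {n : ℕ} (M : Matroid n) where
  open Matroid M

  -- No independent set is larger than a basis (augment the basis otherwise).
  indep-≤-basis : ∀ {B X} → IsBasis M B → Indep X → ∣ X ∣ ≤ ∣ B ∣
  indep-≤-basis {B} {X} (indep-B , maximal-B) indep-X = ≮⇒≥ larger-impossible
    where
    larger-impossible : ¬ ∣ B ∣ < ∣ X ∣
    larger-impossible ∣B∣<∣X∣ with indep-aug indep-B indep-X ∣B∣<∣X∣
    ... | f , _ , f∉B , indep-B+f =
      f∉B (subst (f ∈_) (maximal-B (B ∪ ⁅ f ⁆) indep-B+f (p⊆p∪q ⁅ f ⁆)) (q⊆p∪q B ⁅ f ⁆ (x∈⁅x⁆ f)))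

  basis-of-size : ∀ {B J} → IsBasis M B → Indep J → ∣ J ∣ ≡ ∣ B ∣ → IsBasis M J
  basis-of-size {B} {J} basis-B indep-J ∣J∣≡∣B∣ = indep-J , λ X indep-X J⊆X →
    ⊆-∣∣≤⇒≡ J X J⊆X (subst (∣ X ∣ ≤_) (sym ∣J∣≡∣B∣) (indep-≤-basis basis-B indep-X))

  grow : ∀ k {A B} → Indep A → Indep B → ∣ A ∣ + k ≤ ∣ B ∣ →
         ∃ λ A′ → A ⊆ A′ × A′ ⊆ A ∪ B × Indep A′ × ∣ A′ ∣ ≡ ∣ A ∣ + k
  grow zero {A} {B} indep-A _ _ = A , (λ x∈A → x∈A) , p⊆p∪q B , indep-A , sym (+-identityʳ ∣ A ∣)
  grow (suc k) {A} {B} indep-A indep-B ∣A∣+1+k≤∣B∣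
    with grow k indep-A indep-B (≤-trans (+-monoʳ-≤ ∣ A ∣ (n≤1+n k)) ∣A∣+1+k≤∣B∣)
  ... | A′ , A⊆A′ , A′⊆A∪B , indep-A′ , ∣A′∣≡∣A∣+k
    with indep-aug indep-A′ indep-B
           (subst (_< ∣ B ∣) (sym ∣A′∣≡∣A∣+k) (subst (_≤ ∣ B ∣) (+-suc ∣ A ∣ k) ∣A∣+1+k≤∣B∣))
  ... | f , f∈B , f∉A′ , indep-A′+f =
    A′ ∪ ⁅ f ⁆ , (λ x∈A → p⊆p∪q ⁅ f ⁆ (A⊆A′ x∈A)) , ∪⁅⁆-⊆ A′⊆A∪B (q⊆p∪q A B f∈B) , indep-A′+f ,
    trans (∣p∪⁅x⁆∣≡1+∣p∣ A′ f f∉A′) (trans (cong suc ∣A′∣≡∣A∣+k) (sym (+-suc ∣ A ∣ k)))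

  extend-to-basis-size : ∀ {Y B} → Indep Y → IsBasis M B →
                         ∃ λ A → Y ⊆ A × A ⊆ Y ∪ B × Indep A × ∣ A ∣ ≡ ∣ B ∣
  extend-to-basis-size {Y} {B} indep-Y basis-B =
    let (A , Y⊆A , A⊆Y∪B , indep-A , ∣A∣≡∣Y∣+[∣B∣∸∣Y∣]) =
          grow (∣ B ∣ ∸ ∣ Y ∣) indep-Y (proj₁ basis-B) (≤-reflexive ∣Y∣+[∣B∣∸∣Y∣]≡∣B∣)
    in A , Y⊆A , A⊆Y∪B , indep-A , trans ∣A∣≡∣Y∣+[∣B∣∸∣Y∣] ∣Y∣+[∣B∣∸∣Y∣]≡∣B∣
    where
    ∣Y∣+[∣B∣∸∣Y∣]≡∣B∣ : ∣ Y ∣ + (∣ B ∣ ∸ ∣ Y ∣) ≡ ∣ B ∣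
    ∣Y∣+[∣B∣∸∣Y∣]≡∣B∣ = m+[n∸m]≡n (indep-≤-basis basis-B indep-Y)

  basis-exchange : ∀ {A B e} → IsBasis M B → e ∈ B → Indep A → ∣ A ∣ ≡ ∣ B ∣ → e ∉ A →
                   ∃ λ f → f ∈ A × f ∉ B × IsBasis M ((B - e) ∪ ⁅ f ⁆)
  basis-exchange {A} {B} {e} basis-B e∈B indep-A ∣A∣≡∣B∣ e∉A
    with indep-aug (indep-⊆ (p─q⊆p B ⁅ e ⁆) (proj₁ basis-B)) indep-A
                   (subst (∣ B - e ∣ <_) (sym ∣A∣≡∣B∣) (≤-reflexive (1+∣p-x∣≡∣p∣ B e e∈B)))
  ... | f , f∈A , f∉B-e , indep-B-e+f =
    f , f∈A , f∉B ,
    basis-of-size basis-B indep-B-e+f (trans (∣p∪⁅x⁆∣≡1+∣p∣ (B - e) f f∉B-e) (1+∣p-x∣≡∣p∣ B e e∈B))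
    where
    f∉B : f ∉ B
    f∉B f∈B = f∉B-e (x∈p∧x≢y⇒x∈p-y f∈B (λ f≡e → e∉A (subst (_∈ A) f≡e f∈A)))

  -- Minimality of a cocircuit D: a basis avoiding D - e (for any e) contains
  -- e, since otherwise it would avoid D and make D coindependent.
  basis-meeting-cocircuit-once : ∀ {D} e → ¬ CoIndep M D → CoIndep M (D - e) →
                                 ∃ λ B → IsBasis M B × e ∈ B × B - e ⊆ ∁ D
  basis-meeting-cocircuit-once {D} e dependent-D (B , basis-B , B⊆∁[D-e]) = by-cases (e ∈? B)
    where
    avoids : ∀ {x} → x ∈ B → x ≢ e → x ∈ ∁ D
    avoids x∈B x≢e = x∉p⇒x∈∁p (λ x∈D → x∈∁p⇒x∉p (B⊆∁[D-e] x∈B) (x∈p∧x≢y⇒x∈p-y x∈D x≢e))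

    by-cases : Dec (e ∈ B) → ∃ λ B′ → IsBasis M B′ × e ∈ B′ × B′ - e ⊆ ∁ D
    by-cases (no e∉B) =
      ⊥-elim (dependent-D (B , basis-B , λ x∈B → avoids x∈B (λ x≡e → e∉B (subst (_∈ B) x≡e x∈B))))
    by-cases (yes e∈B) = B , basis-B , e∈B , λ {x} x∈B-e →
      let (x∈B , x∉⁅e⁆) = x∈p─q⁻ B ⁅ e ⁆ x x∈B-e in avoids x∈B (x∉⁅y⁆⇒x≢y x∉⁅e⁆)

  independent-avoiding+e : ∀ {D B Y e} → ¬ CoIndep M D → IsBasis M B → e ∈ B → B - e ⊆ ∁ D →
                           Indep Y → Y ⊆ ∁ D → Indep (Y ∪ ⁅ e ⁆)
  independent-avoiding+e {D} {B} {Y} {e} dependent-D basis-B e∈B B-e⊆∁D indep-Y Y⊆∁D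
    with extend-to-basis-size indep-Y basis-B
  ... | A , Y⊆A , A⊆Y∪B , indep-A , ∣A∣≡∣B∣ with e ∈? A
  ...   | yes e∈A = indep-⊆ (∪⁅⁆-⊆ Y⊆A e∈A) indep-A
  ...   | no e∉A with basis-exchange basis-B e∈B indep-A ∣A∣≡∣B∣ e∉A
  ...     | f , f∈A , f∉B , basis-B-e+f =
    ⊥-elim (dependent-D ((B - e) ∪ ⁅ f ⁆ , basis-B-e+f , ∪⁅⁆-⊆ B-e⊆∁D (Y⊆∁D f∈Y)))
    where
    f∈Y : f ∈ Y
    f∈Y with x∈p∪q⁻ Y B (A⊆Y∪B f∈A)
    ... | inj₁ f∈Y = f∈Y
    ... | inj₂ f∈B = ⊥-elim (f∉B f∈B)

open MatroidFacts

lemma5p2 : (t : ℕ) → 1 ≤ t → (n : ℕ) → (M : Matroid n) →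
    HasProperty M t (2 * t) → ¬ HasUniformRestriction M t (3 * t)
lemma5p2 t 1≤t n M property (X , ∣X∣≡3t , uniform)
  with subset-of-size t X (subst (t ≤_) (sym ∣X∣≡3t) (m≤n*m t 3))
... | T , T⊆X , ∣T∣≡t with proj₂ (property T ∣T∣≡t)
... | D , (dependent-D , minimal-D) , T⊆D , ∣D∣≡2t
  with member-of-nonempty T (subst (1 ≤_) (sym ∣T∣≡t) 1≤t)
... | e , e∈T
  with basis-meeting-cocircuit-once M e dependent-D (minimal-D (D - e) (x∈p⇒p-x⊂p (T⊆D e∈T)))
... | B , basis-B , e∈B , B-e⊆∁D with subset-of-size t (X ─ D) (3t-2t≥t t X D ∣X∣≡3t ∣D∣≡2t)
... | Y , Y⊆X─D , ∣Y∣≡t = n≮n t (subst (_≤ t) ∣Y+e∣≡1+t (Equivalence.to (uniform (Y ∪ ⁅ e ⁆) Y+e⊆X) indep-Y+e))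
  where
  open Matroid M using (Indep)
  Y⊆X : Y ⊆ X
  Y⊆X x∈Y = p─q⊆p X D (Y⊆X─D x∈Y)
  Y⊆∁D : Y ⊆ ∁ D
  Y⊆∁D {x} x∈Y = x∉p⇒x∈∁p (proj₂ (x∈p─q⁻ X D x (Y⊆X─D x∈Y)))
  indep-Y+e : Indep (Y ∪ ⁅ e ⁆)
  indep-Y+e = independent-avoiding+e M dependent-D basis-B e∈B B-e⊆∁D
                (Equivalence.from (uniform Y Y⊆X) (≤-reflexive ∣Y∣≡t)) Y⊆∁D
  Y+e⊆X : Y ∪ ⁅ e ⁆ ⊆ X
  Y+e⊆X = ∪⁅⁆-⊆ Y⊆X (T⊆X e∈T)
  ∣Y+e∣≡1+t : ∣ Y ∪ ⁅ e ⁆ ∣ ≡ suc t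
  ∣Y+e∣≡1+t = trans (∣p∪⁅x⁆∣≡1+∣p∣ Y e (λ e∈Y → x∈∁p⇒x∉p (Y⊆∁D e∈Y) (T⊆D e∈T))) (cong suc ∣Y∣≡t)
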